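{- Let $\mathbb{P}^m_r$ be an $r$-uniform hyperpath with $m$ edges, where $r\ge 3$. Then $\lambda(\mathbb{P}^m_r)=2r-2$ if $m=1$, $\lambda(\mathbb{P}^m_r)=2r-1$ if $m=2$, and $\lambda(\mathbb{P}^m_r)=2r$ if $m\ge 3$.
   Context: A hypergraph $\mathbb{H}=(V,E)$ consists of a finite vertex set $V$ and a family $E$ of subsets of $V$ (edges); all hypergraphs are simple: every edge has at least two elements and no edge contains another. An $r$-uniform hypergraph (all edges of size $r$) with $m$ edges is a hyperpath $\mathbb{P}^m_r$ if its edges and some vertices can be arranged in a sequence $e_1v_1e_2v_2\cdots e_{m-1}v_{m-1}e_m$ such that for $1\le i<j\le m$, $e_i\cap e_j=\emptyset$ if $j\ne i+1$ and $e_i\cap e_{i+1}=\{v_i\}$. An $L(2,1)$-colouring of $\mathbb{H}$ is a map $f:V\to\mathbb{Z}_{\ge0}$ such that $|f(u)-f(v)|\ge 2$ whenever $u\neq v$ lie in a common edge, and $|f(u)-f(v)|\ge 1$ whenever $u\ne v$ and there exist edges $e_1\ni v$, $e_2\ni u$ with $(e_1\cap e_2)\setminus\{u,v\}\neq\emptyset$. The span of $f$ is $\max f-\min f$, and $\lambda(\mathbb{H})$ is the minimum span of an $L(2,1)$-colouring of $\mathbb{H}$. -}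

module Defs where

open import Data.Nat using (ℕ; zero; suc; _≤_; _<_; _⊔_; _⊓_; _∸_; ∣_-_∣)
open import Data.Fin using (Fin; toℕ)
open import Data.Fin.Subset using (Subset; _∈_; _⊆_; _∩_; ⊥; ⁅_⁆; ∣_∣)
open import Data.List using (foldr; map; allFin)
open import Data.Product using (Σ; _×_; ∃; ∃-syntax)
open import Relation.Nullary using (¬_)
open import Relation.Binary.PropositionalEquality using (_≡_; _≢_)
open import Function.Bundles using (_↔_; Inverse)

-- A finite simple hypergraph: vertex set Fin n, edge family indexed by Fin m
-- (the edge family is a set of m distinct edges; distinctness follows from
-- the simplicity condition "no edge contains another").
record Hypergraph : Set where
  field
    n     : ℕ
    m     : ℕ
    edge  : Fin m → Subset n
    edge-size : ∀ i → 2 ≤ ∣ edge i ∣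
    no-containment : ∀ i j → i ≢ j → ¬ (edge i ⊆ edge j)
open Hypergraph public

Uniform : Hypergraph → ℕ → Set
Uniform H r = ∀ i → ∣ edge H i ∣ ≡ r

-- H is an r-uniform hyperpath (with m H edges): the edges can be arranged
-- in a sequence e_1 v_1 e_2 ... v_{m-1} e_m, i.e. there is an ordering
-- σ : Fin m ↔ Fin m of the edges such that non-consecutive edges are
-- disjoint and consecutive edges meet in exactly one vertex.
IsHyperpath : Hypergraph → ℕ → Set
IsHyperpath H r =
  Uniform H r ×
  Σ (Fin (m H) ↔ Fin (m H)) λ σ →
    let e = λ i → edge H (Inverse.to σ i) in
    ∀ (i j : Fin (m H)) → toℕ i < toℕ j →
      ((suc (toℕ i) ≢ toℕ j → e i ∩ e j ≡ ⊥) ×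
       (suc (toℕ i) ≡ toℕ j → ∃[ v ] (e i ∩ e j ≡ ⁅ v ⁆)))

Adjacent : (H : Hypergraph) → Fin (n H) → Fin (n H) → Set
Adjacent H u v = ∃[ k ] (u ∈ edge H k × v ∈ edge H k)

Distance2 : (H : Hypergraph) → Fin (n H) → Fin (n H) → Set
Distance2 H u v = ∃[ k ] ∃[ l ] ∃[ w ]
  (v ∈ edge H k × u ∈ edge H l × w ∈ edge H k × w ∈ edge H l × w ≢ u × w ≢ v)

IsL21 : (H : Hypergraph) → (Fin (n H) → ℕ) → Set
IsL21 H f =
  (∀ u v → u ≢ v → Adjacent H u v → 2 ≤ ∣ f u - f v ∣) ×
  (∀ u v → u ≢ v → Distance2 H u v → 1 ≤ ∣ f u - f v ∣)

maxF : ∀ {k} → (Fin k → ℕ) → ℕ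
maxF {k} f = foldr _⊔_ 0 (map f (allFin k))

minF : ∀ {k} → (Fin k → ℕ) → ℕ
minF {k} f = foldr _⊓_ (maxF f) (map f (allFin k))

span : ∀ {k} → (Fin k → ℕ) → ℕ
span f = maxF f ∸ minF f

LambdaIs : Hypergraph → ℕ → Set
LambdaIs H s =
  (∃[ f ] (IsL21 H f × span f ≡ s)) ×
  (∀ f → IsL21 H f → s ≤ span f)

-- Let r = L + 1 and let f be an L(2,1)-colouring with least colour lo.  The r colours of an edge
-- are pairwise at least 2 apart, so in increasing order they satisfy c_j ≥ lo + 2j, and the span
-- is at least 2L.  If the span is at most 2L + 1, each c_j lies in the window {lo + 2j, lo + 2j + 1},
-- and once c_j takes the upper value all later ones do.  By the distance-two condition consecutive
-- edges share only the colour of their common vertex, so their sequences agree at exactly one index,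
-- which must be 0 or L.  With span at most 2L all c_j equal lo + 2j and two edges agree everywhere.
-- With three edges, the middle one cannot agree with one neighbour only at 0 and with the other
-- only at L (this forces contradictory values at index 1), so both agreements happen at the same
-- index, although they carry the colours of two distinct vertices.  The upper bounds are explicit
-- colourings, given edge by edge to the vertex shared with the previous edge, the vertex shared with
-- the next edge, and the remaining vertices.

module Submission where

open import Defs
open import Data.Bool.Base using (true; false)
open import Data.Empty using (⊥; ⊥-elim)
open import Data.Fin using (Fin; toℕ; fromℕ<) renaming (zero to fzero; suc to fsuc; _≟_ to _≟ᶠ_)
open import Data.Fin.Properties using (toℕ<n; toℕ-fromℕ<; fromℕ<-toℕ)
  renaming (suc-injective to fsuc-injective)
open import Data.Fin.Subset using (Subset; _∈_; _∉_; _∩_; _∪_; ∁; _⊆_; ⁅_⁆; ∣_∣)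
  renaming (⊥ to ∅; _-_ to _∖_)
open import Data.Fin.Subset.Properties
  using (_∈?_; ∉⊥; x∈⁅x⁆; x∈⁅y⁆⇒x≡y; x∈p∩q⁺; x∈p∩q⁻; p∩q⊆p; x∈p∪q⁺; x∈p∪q⁻; x∉p⇒x∈∁p; x∈∁p⇒x∉p;
         x∈p∧x≢y⇒x∈p-y; x∈p⇒∣p-x∣<∣p∣; p⊆q⇒∣p∣≤∣q∣)
open import Data.List as List using (List; []; _∷_; length; map; allFin)
open import Data.List.Properties using (length-map)
open import Data.List.Membership.Propositional using () renaming (_∈_ to _∈ₗ_)
open import Data.List.Membership.Propositional.Properties using (∈-allFin; ∈-map⁺; ∈-map⁻)
open import Data.List.Relation.Unary.All as All using (All; []; _∷_)
open import Data.List.Relation.Unary.All.Properties using () renaming (map⁺ to All-map⁺)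
open import Data.List.Relation.Unary.AllPairs using (AllPairs; []; _∷_)
open import Data.List.Relation.Unary.AllPairs.Properties using () renaming (map⁺ to AllPairs-map⁺)
open import Data.List.Relation.Unary.Any using (here; there)
open import Data.List.Relation.Unary.Linked using (Linked; []; [-]; _∷_)
open import Data.List.Relation.Unary.Unique.Propositional using (Unique)
import Data.List.Relation.Unary.Unique.Propositional.Properties as Unique
open import Data.List.Relation.Binary.Permutation.Propositional using (↭-sym; ↭⇒↭ₛ)
open import Data.List.Relation.Binary.Permutation.Propositional.Properties using (↭-length; ∈-resp-↭)
open import Data.Nat
open import Data.Nat.DivMod using ([m+kn]%n≡m%n)
open import Data.Nat.Properties
open import Data.Product using (_×_; _,_; proj₁; proj₂; ∃-syntax)
open import Data.Sum using (_⊎_; inj₁; inj₂; [_,_]′)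
open import Data.Vec using ([]; _∷_; here; there)
open import Function using (_∘_)
open import Function.Bundles using (Inverse)
open import Relation.Binary.Definitions using (tri<; tri≈; tri>)
open import Relation.Binary.PropositionalEquality
open import Relation.Nullary using (¬_; yes; no; contradiction)
open import Data.List.Relation.Binary.Permutation.Setoid.Properties (setoid ℕ) using (AllPairs-resp-↭)
open import Data.List.Sort ≤-decTotalOrder using (sort; sort-↭; sort-↗)

record Apart (x y : ℕ) : Set where
  constructor apart
  field
    2≤∣-∣ : 2 ≤ ∣ x - y ∣

apart-sym : ∀ {x y} → Apart x y → Apart y x
apart-sym {x} {y} (apart p) = apart (subst (2 ≤_) (∣-∣-comm x y) p)

apart⇒≢ : ∀ {x y} → Apart x y → x ≢ y
apart⇒≢ {x} (apart p) refl = contradiction (subst (2 ≤_) (∣n-n∣≡0 x) p) λ ()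

≢⇒0<∣-∣ : ∀ {x y} → x ≢ y → 0 < ∣ x - y ∣
≢⇒0<∣-∣ x≢y = n≢0⇒n>0 (x≢y ∘ ∣m-n∣≡0⇒m≡n)

apart∧≤⇒2+≤ : ∀ {x y} → x ≤ y → Apart x y → 2 + x ≤ y
apart∧≤⇒2+≤ x≤y (apart p) = m≤o∸n⇒m+n≤o 2 x≤y (subst (2 ≤_) (m≤n⇒∣m-n∣≡n∸m x≤y) p)

2+≤⇒apart : ∀ {x y} → 2 + x ≤ y → Apart x y
2+≤⇒apart {x} p =
  apart (subst (2 ≤_) (sym (m≤n⇒∣m-n∣≡n∸m (≤-trans (m≤n+m x 2) p))) (m+n≤o⇒m≤o∸n 2 p))

module _ {k : ℕ} (f : Fin k → ℕ) where

  private
    values = map f (allFin k)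

    ∈-values : ∀ u → f u ∈ₗ values
    ∈-values u = ∈-map⁺ f (∈-allFin u)

  f≤maxF : ∀ u → f u ≤ maxF f
  f≤maxF u = go values (∈-values u)
    where
    go : ∀ {x} xs → x ∈ₗ xs → x ≤ List.foldr _⊔_ 0 xs
    go (y ∷ _) (here refl) = m≤m⊔n y _
    go (y ∷ xs) (there x∈xs) = ≤-trans (go xs x∈xs) (m≤n⊔m y _)

  minF≤f : ∀ u → minF f ≤ f u
  minF≤f u = go values (∈-values u)
    where
    go : ∀ {x} xs → x ∈ₗ xs → List.foldr _⊓_ (maxF f) xs ≤ x
    go (y ∷ _) (here refl) = m⊓n≤m y _
    go (y ∷ xs) (there x∈xs) = ≤-trans (m⊓n≤n y _) (go xs x∈xs)

  minF≤maxF : minF f ≤ maxF f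
  minF≤maxF = go values
    where
    go : ∀ xs → List.foldr _⊓_ (maxF f) xs ≤ maxF f
    go [] = ≤-refl
    go (y ∷ xs) = ≤-trans (m⊓n≤n y _) (go xs)

  span≤ : ∀ {B} → (∀ u → f u ≤ B) → span f ≤ B
  span≤ {B} f≤B = ≤-trans (m∸n≤m (maxF f) (minF f)) (go (allFin k))
    where
    go : ∀ us → List.foldr _⊔_ 0 (map f us) ≤ B
    go [] = z≤n
    go (u ∷ us) = ⊔-lub (f≤B u) (go us)

  maxF≡span+minF : maxF f ≡ span f + minF f
  maxF≡span+minF = sym (m∸n+n≡m minF≤maxF)

elements : ∀ {n} → Subset n → List (Fin n)
elements [] = []
elements (true ∷ p) = fzero ∷ map fsuc (elements p)
elements (false ∷ p) = map fsuc (elements p)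

length-elements : ∀ {n} (p : Subset n) → length (elements p) ≡ ∣ p ∣
length-elements [] = refl
length-elements (true ∷ p) = cong suc (trans (length-map fsuc (elements p)) (length-elements p))
length-elements (false ∷ p) = trans (length-map fsuc (elements p)) (length-elements p)

∈-elements⁻ : ∀ {n} (p : Subset n) {x} → x ∈ₗ elements p → x ∈ p
∈-elements⁻ (true ∷ p) (here refl) = here
∈-elements⁻ (true ∷ p) (there x∈) with ∈-map⁻ fsuc x∈
... | _ , y∈ , refl = there (∈-elements⁻ p y∈)
∈-elements⁻ (false ∷ p) x∈ with ∈-map⁻ fsuc x∈
... | _ , y∈ , refl = there (∈-elements⁻ p y∈)

∈-elements⁺ : ∀ {n} (p : Subset n) {x} → x ∈ p → x ∈ₗ elements p
∈-elements⁺ (true ∷ p) here = here refl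
∈-elements⁺ (true ∷ p) (there x∈p) = there (∈-map⁺ fsuc (∈-elements⁺ p x∈p))
∈-elements⁺ (false ∷ p) (there x∈p) = ∈-map⁺ fsuc (∈-elements⁺ p x∈p)

elements-unique : ∀ {n} (p : Subset n) → Unique (elements p)
elements-unique [] = []
elements-unique (true ∷ p) =
  All-map⁺ (All.tabulate (λ _ ())) ∷ Unique.map⁺ fsuc-injective (elements-unique p)
elements-unique (false ∷ p) = Unique.map⁺ fsuc-injective (elements-unique p)

_<₂_ : ℕ → ℕ → Set
x <₂ y = 2 + x ≤ y

sort-apart : ∀ {xs} → AllPairs Apart xs → Linked _<₂_ (sort xs)
sort-apart {xs} xs-apart =
  go (sort-↗ xs) (AllPairs-resp-↭ apart-sym (resp₂ Apart) (↭⇒↭ₛ (↭-sym (sort-↭ xs))) xs-apart)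
  where
  go : ∀ {ys} → Linked _≤_ ys → AllPairs Apart ys → Linked _<₂_ ys
  go [] _ = []
  go [-] _ = [-]
  go (x≤y ∷ sorted) ((x#y ∷ _) ∷ rest) = apart∧≤⇒2+≤ x≤y x#y ∷ go sorted rest

-- Indexing with a default value, so that an edge's sorted colours form a sequence ℕ → ℕ.
nth : List ℕ → ℕ → ℕ
nth [] _ = 0
nth (x ∷ xs) zero = x
nth (x ∷ xs) (suc j) = nth xs j

nth-∈ : ∀ xs {j} → j < length xs → nth xs j ∈ₗ xs
nth-∈ (x ∷ xs) {zero} _ = here refl
nth-∈ (x ∷ xs) {suc j} j<len = there (nth-∈ xs (s≤s⁻¹ j<len))

∈⇒nth : ∀ {xs x} → x ∈ₗ xs → ∃[ j ] (j < length xs × nth xs j ≡ x)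
∈⇒nth (here refl) = 0 , z<s , refl
∈⇒nth (there x∈) with ∈⇒nth x∈
... | j , j<len , eq = suc j , s≤s j<len , eq

nth-linked : ∀ {R : ℕ → ℕ → Set} {xs j} → Linked R xs → suc j < length xs →
             R (nth xs j) (nth xs (suc j))
nth-linked [-] (s≤s ())
nth-linked {j = zero} (xRy ∷ _) _ = xRy
nth-linked {j = suc j} (_ ∷ linked) j<len = nth-linked linked (s≤s⁻¹ j<len)

allPairs-restrict : ∀ {A : Set} {P : A → Set} {R S : A → A → Set} {xs} →
              (∀ {x y} → P x → P y → R x y → S x y) → All P xs → AllPairs R xs → AllPairs S xs
allPairs-restrict R⇒S [] [] = []
allPairs-restrict R⇒S (px ∷ pxs) (rx ∷ rxs) =
  All.zipWith (λ {y} (py , r) → R⇒S px py r) (pxs , rx) ∷ allPairs-restrict R⇒S pxs rxs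

-- Multiples are written j * 2, so that suc j * 2 reduces to 2 + j * 2.
record Spaced (L : ℕ) : Set where
  field
    seq : ℕ → ℕ
    gap : ∀ {j} → j < L → 2 + seq j ≤ seq (suc j)

  spread : ∀ {j} → j ≤ L → j * 2 + seq 0 ≤ seq j
  spread {zero} _ = ≤-refl
  spread {suc j} j<L = ≤-trans (s≤s (s≤s (spread (<⇒≤ j<L)))) (gap j<L)

record Window (lo L : ℕ) : Set where
  field
    spaced : Spaced L
  open Spaced spaced public
  field
    bottom : lo ≤ seq 0
    top : seq L ≤ suc (L * 2 + lo)

  Lower Upper : ℕ → Set
  Lower j = seq j ≡ j * 2 + lo
  Upper j = seq j ≡ suc (j * 2 + lo)

  low : ∀ {j} → j ≤ L → j * 2 + lo ≤ seq j
  low {j} j≤L = ≤-trans (+-monoʳ-≤ (j * 2) bottom) (spread j≤L)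

  high : ∀ {j} → j ≤ L → seq j ≤ suc (j * 2 + lo)
  high {j} j≤L = go (L ∸ j) (m+[n∸m]≡n j≤L)
    where
    go : ∀ d {j} → j + d ≡ L → seq j ≤ suc (j * 2 + lo)
    go zero {j} j+0≡L =
      subst (λ k → seq k ≤ suc (k * 2 + lo)) (sym (trans (sym (+-identityʳ j)) j+0≡L)) top
    go (suc d) {j} j+d≡L = ≤-pred (≤-pred (≤-trans (gap j<L) (go d (trans (sym (+-suc j d)) j+d≡L))))
      where
      j<L : j < L
      j<L = subst (j <_) j+d≡L (m<m+n j z<s)

  lower-or-upper : ∀ {j} → j ≤ L → Lower j ⊎ Upper j
  lower-or-upper j≤L with m≤n⇒m<n∨m≡n (high j≤L)
  ... | inj₁ (s≤s <suc) = inj₁ (≤-antisym <suc (low j≤L))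
  ... | inj₂ ≡suc = inj₂ ≡suc

  upper-mono : ∀ {i j} → i ≤ j → j ≤ L → Upper i → Upper j
  upper-mono {i} {zero} z≤n _ up = up
  upper-mono {i} {suc j} i≤1+j 1+j≤L up with m≤n⇒m<n∨m≡n i≤1+j
  ... | inj₂ refl = up
  ... | inj₁ (s≤s i≤j) = ≤-antisym (high 1+j≤L)
          (subst (λ x → 2 + x ≤ seq (suc j)) (upper-mono i≤j (<⇒≤ 1+j≤L) up) (gap 1+j≤L))

  lower-mono : ∀ {i j} → i ≤ j → j ≤ L → Lower j → Lower i
  lower-mono {i} {j} i≤j j≤L lowⱼ with lower-or-upper (≤-trans i≤j j≤L)
  ... | inj₁ lowᵢ = lowᵢ
  ... | inj₂ upᵢ = contradiction (trans (sym lowⱼ) (upper-mono i≤j j≤L upᵢ)) (<⇒≢ (n<1+n _))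

window-index-unique : ∀ {lo i j x} → i * 2 + lo ≤ x → x ≤ suc (i * 2 + lo) →
                      j * 2 + lo ≤ x → x ≤ suc (j * 2 + lo) → i ≡ j
window-index-unique {lo} {i} {j} {x} lᵢ hᵢ lⱼ hⱼ with <-cmp i j
... | tri≈ _ i≡j _ = i≡j
... | tri< i<j _ _ = ⊥-elim (n≮n x (≤-trans (s≤s hᵢ) (≤-trans (+-monoˡ-≤ lo (*-monoˡ-≤ 2 i<j)) lⱼ)))
... | tri> _ _ j<i = ⊥-elim (n≮n x (≤-trans (s≤s hⱼ) (≤-trans (+-monoˡ-≤ lo (*-monoˡ-≤ 2 j<i)) lᵢ)))

module _ {lo L : ℕ} where
  open Window

  AgreeOnlyAt : Window lo L → Window lo L → ℕ → Set
  AgreeOnlyAt A B p =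
    p ≤ L × seq A p ≡ seq B p × (∀ {j} → j ≤ L → seq A j ≡ seq B j → j ≡ p)

  -- Once a window sequence takes its upper value it keeps it, so two of them agree on an initial or
  -- on a final segment.
  agreement-at-end : ∀ {A B p} → AgreeOnlyAt A B p →
                     (p ≡ 0 × Lower B 0) ⊎ (p ≡ L × Upper B L)
  agreement-at-end {A} {B} (p≤L , agree , only) with lower-or-upper B p≤L
  ... | inj₁ lowBₚ = inj₁ (sym (only z≤n (trans lowA₀ (sym lowB₀))) , lowB₀)
    where
    lowA₀ = lower-mono A z≤n p≤L (trans agree lowBₚ)
    lowB₀ = lower-mono B z≤n p≤L lowBₚ
  ... | inj₂ upBₚ = inj₂ (sym (only ≤-refl (trans upA (sym upB))) , upB)
    where
    upA = upper-mono A p≤L ≤-refl (trans agree upBₚ)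
    upB = upper-mono B p≤L ≤-refl upBₚ

  ends-disagree : ∀ {A B C} → 2 ≤ L → AgreeOnlyAt A B 0 → AgreeOnlyAt C B L →
                  Lower B 0 → Upper B L → ⊥
  ends-disagree {A} {B} {C} 2≤L (_ , _ , onlyA) (_ , _ , onlyC) lowB₀ upBL =
    <⇒≢ 2≤L (onlyC 1≤L (trans upC₁ (sym upB₁)))
    where
    1≤L : 1 ≤ L
    1≤L = ≤-trans (s≤s z≤n) 2≤L
    lowA₁ : Lower A 1
    lowA₁ with lower-or-upper A ≤-refl
    ... | inj₁ lowAL = lower-mono A 1≤L ≤-refl lowAL
    ... | inj₂ upAL = contradiction (sym (onlyA ≤-refl (trans upAL (sym upBL)))) (<⇒≢ 1≤L)
    upB₁ : Upper B 1
    upB₁ with lower-or-upper B 1≤L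
    ... | inj₁ lowB₁ = contradiction (onlyA 1≤L (trans lowA₁ (sym lowB₁))) λ ()
    ... | inj₂ up = up
    upC₁ : Upper C 1
    upC₁ with lower-or-upper C z≤n
    ... | inj₁ lowC₀ = contradiction (onlyC z≤n (trans lowC₀ (sym lowB₀))) (<⇒≢ 1≤L)
    ... | inj₂ upC₀ = upper-mono C z≤n 1≤L upC₀

  agreements-coincide : ∀ {A B C p q} → 2 ≤ L → AgreeOnlyAt A B p → AgreeOnlyAt C B q → p ≡ q
  agreements-coincide {A} {B} {C} 2≤L agAB agCB
    with agreement-at-end {A} {B} agAB | agreement-at-end {C} {B} agCB
  ... | inj₁ (refl , _) | inj₁ (refl , _) = refl
  ... | inj₂ (refl , _) | inj₂ (refl , _) = refl
  ... | inj₁ (refl , lowB₀) | inj₂ (refl , upBL) =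
    ⊥-elim (ends-disagree {A} {B} {C} 2≤L agAB agCB lowB₀ upBL)
  ... | inj₂ (refl , upBL) | inj₁ (refl , lowB₀) =
    ⊥-elim (ends-disagree {C} {B} {A} 2≤L agCB agAB lowB₀ upBL)

window-aligned : ∀ {lo L i j} (A B : Window lo L) → i ≤ L → j ≤ L →
                 Window.seq A i ≡ Window.seq B j → i ≡ j
window-aligned A B i≤L j≤L eq =
  window-index-unique (Window.low A i≤L) (Window.high A i≤L)
    (subst (_ ≤_) (sym eq) (Window.low B j≤L)) (subst (_≤ _) (sym eq) (Window.high B j≤L))

module Hyperpath (H : Hypergraph) (r : ℕ) (hp : IsHyperpath H r) where

  private
    open module σ = Inverse (proj₁ (proj₂ hp)) using () renaming (to to order; from to position)

  edgeAt : ∀ {i} → i < m H → Fin (m H)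
  edgeAt i<m = order (fromℕ< i<m)

  -- E i is the (i+1)-st edge along the path, and is empty past its end.
  E : ℕ → Subset (n H)
  E i with i <? m H
  ... | yes i<m = edge H (edgeAt i<m)
  ... | no _ = ∅

  E≡edgeAt : ∀ {i} (i<m : i < m H) → E i ≡ edge H (edgeAt i<m)
  E≡edgeAt {i} i<m with i <? m H
  ... | yes _ = refl
  ... | no i≮m = contradiction i<m i≮m

  ∈E⇒<m : ∀ {x i} → x ∈ E i → i < m H
  ∈E⇒<m {i = i} x∈ with i <? m H
  ... | yes i<m = i<m
  ... | no _ = contradiction x∈ ∉⊥

  ∈E⇒∈edgeAt : ∀ {x i} (i<m : i < m H) → x ∈ E i → x ∈ edge H (edgeAt i<m)
  ∈E⇒∈edgeAt {x} i<m = subst (x ∈_) (E≡edgeAt i<m)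

  ∈edge⇒∈E : ∀ {x k} → x ∈ edge H k → x ∈ E (toℕ (position k))
  ∈edge⇒∈E {x} {k} x∈k = subst (x ∈_) (sym (E≡edgeAt (toℕ<n (position k))))
    (subst (λ l → x ∈ edge H l) (sym (trans (cong order (fromℕ<-toℕ _ _)) (σ.strictlyInverseˡ k))) x∈k)

  ∣E∣≡r : ∀ {i} → i < m H → ∣ E i ∣ ≡ r
  ∣E∣≡r i<m = trans (cong ∣_∣ (E≡edgeAt i<m)) (proj₁ hp _)

  private
    Meet : ℕ → ℕ → Subset (n H) → Subset (n H) → Set
    Meet i j X Y = (suc i ≢ j → X ∩ Y ≡ ∅) × (suc i ≡ j → ∃[ v ] (X ∩ Y ≡ ⁅ v ⁆))

    meet : ∀ {i j} (i<m : i < m H) (j<m : j < m H) → i < j → Meet i j (E i) (E j)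
    meet i<m j<m i<j =
      subst₂ (Meet _ _) (sym (E≡edgeAt i<m)) (sym (E≡edgeAt j<m))
        (subst₂ (λ a b → Meet a b (edge H (edgeAt i<m)) (edge H (edgeAt j<m)))
                (toℕ-fromℕ< i<m) (toℕ-fromℕ< j<m)
          (proj₂ (proj₂ hp) (fromℕ< i<m) (fromℕ< j<m)
            (subst₂ _<_ (sym (toℕ-fromℕ< i<m)) (sym (toℕ-fromℕ< j<m)) i<j)))

  common-vertex⇒consecutive : ∀ {x i j} → x ∈ E i → x ∈ E j → i < j → suc i ≡ j
  common-vertex⇒consecutive {x} {i} {j} x∈i x∈j i<j with suc i ≟ j
  ... | yes 1+i≡j = 1+i≡j
  ... | no 1+i≢j = contradiction
          (subst (x ∈_) (proj₁ (meet (∈E⇒<m x∈i) (∈E⇒<m x∈j) i<j) 1+i≢j) (x∈p∩q⁺ (x∈i , x∈j))) ∉⊥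

  meeting-edge≡next : ∀ {x i j} → x ∈ E i → x ∈ E j → i < j → E j ≡ E (suc i)
  meeting-edge≡next x∈i x∈j i<j = cong E (sym (common-vertex⇒consecutive x∈i x∈j i<j))

  shared-vertex-unique : ∀ {x y i} → x ∈ E i → x ∈ E (suc i) → y ∈ E i → y ∈ E (suc i) → x ≡ y
  shared-vertex-unique x∈i x∈i′ y∈i y∈i′
    with proj₂ (meet (∈E⇒<m x∈i) (∈E⇒<m x∈i′) ≤-refl) refl
  ... | v , i∩i′≡v = trans (∈v (x∈p∩q⁺ (x∈i , x∈i′))) (sym (∈v (x∈p∩q⁺ (y∈i , y∈i′))))
    where
    ∈v : ∀ {z} → z ∈ E _ ∩ E _ → z ≡ v
    ∈v {z} z∈ = x∈⁅y⁆⇒x≡y v (subst (z ∈_) i∩i′≡v z∈)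

  shared-vertex : ∀ {i} → suc i < m H → ∃[ v ] (v ∈ E i × v ∈ E (suc i))
  shared-vertex {i} 1+i<m with proj₂ (meet (<-trans (n<1+n i) 1+i<m) 1+i<m ≤-refl) refl
  ... | v , i∩i′≡v = v , x∈p∩q⁻ _ _ (subst (v ∈_) (sym i∩i′≡v) (x∈⁅x⁆ v))

  E-adjacent : ∀ {u w i} → u ∈ E i → w ∈ E i → Adjacent H u w
  E-adjacent u∈ w∈ = _ , ∈E⇒∈edgeAt i<m u∈ , ∈E⇒∈edgeAt i<m w∈
    where i<m = ∈E⇒<m u∈

  E-distance2 : ∀ {u w v i j} → u ∈ E i → v ∈ E i → v ∈ E j → w ∈ E j → v ≢ u → v ≢ w →
                Distance2 H u w
  E-distance2 u∈ v∈ v∈′ w∈ v≢u v≢w =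
    _ , _ , _ , ∈E⇒∈edgeAt j<m w∈ , ∈E⇒∈edgeAt i<m u∈ , ∈E⇒∈edgeAt j<m v∈′ , ∈E⇒∈edgeAt i<m v∈ ,
    v≢u , v≢w
    where
    i<m = ∈E⇒<m u∈
    j<m = ∈E⇒<m w∈

  SameEdge ConsecutiveEdges : Fin (n H) → Fin (n H) → Set
  SameEdge u w = ∃[ i ] (u ∈ E i × w ∈ E i)
  ConsecutiveEdges u w = ∃[ i ] (u ∈ E i × w ∈ E (suc i))

  adjacent⇒same-edge : ∀ {u w} → Adjacent H u w → SameEdge u w
  adjacent⇒same-edge (k , u∈k , w∈k) = _ , ∈edge⇒∈E u∈k , ∈edge⇒∈E w∈k

  distance2-cases : ∀ {u w} → Distance2 H u w →
                    SameEdge u w ⊎ ConsecutiveEdges u w ⊎ ConsecutiveEdges w u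
  distance2-cases (k , l , x , w∈k , u∈l , x∈k , x∈l , _ , _)
    with <-cmp (toℕ (position l)) (toℕ (position k))
  ... | tri≈ _ l≡k _ = inj₁ (_ , ∈edge⇒∈E u∈l , subst (λ i → _ ∈ E i) (sym l≡k) (∈edge⇒∈E w∈k))
  ... | tri< l<k _ _ = inj₂ (inj₁ (_ , ∈edge⇒∈E u∈l ,
    subst (_ ∈_) (meeting-edge≡next (∈edge⇒∈E x∈l) (∈edge⇒∈E x∈k) l<k) (∈edge⇒∈E w∈k)))
  ... | tri> _ _ k<l = inj₂ (inj₂ (_ , ∈edge⇒∈E w∈k ,
    subst (_ ∈_) (meeting-edge≡next (∈edge⇒∈E x∈k) (∈edge⇒∈E x∈l) k<l) (∈edge⇒∈E u∈l)))

module LowerBound (H : Hypergraph) (L : ℕ) (hp : IsHyperpath H (suc L))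
                  {f : Fin (n H) → ℕ} (f-L21 : IsL21 H f) where
  open Hyperpath H (suc L) hp

  private
    lo hi : ℕ
    lo = minF f
    hi = maxF f

  E-apart : ∀ {u w i} → u ∈ E i → w ∈ E i → u ≢ w → Apart (f u) (f w)
  E-apart u∈ w∈ u≢w = apart (proj₁ f-L21 _ _ u≢w (E-adjacent u∈ w∈))

  shared-colour : ∀ {u w v i} → v ∈ E i → v ∈ E (suc i) → u ∈ E i → w ∈ E (suc i) →
                  f u ≡ f w → f u ≡ f v
  shared-colour {u} {w} {v} v∈i v∈i′ u∈i w∈i′ fu≡fw with u ≟ᶠ v | w ≟ᶠ v | u ≟ᶠ w
  ... | yes refl | _ | _ = refl
  ... | no _ | yes refl | _ = fu≡fw
  ... | no u≢v | no _ | yes refl = contradiction (shared-vertex-unique u∈i w∈i′ v∈i v∈i′) u≢v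
  ... | no u≢v | no w≢v | no u≢w =
    contradiction (proj₂ f-L21 u w u≢w (E-distance2 u∈i v∈i v∈i′ w∈i′ (u≢v ∘ sym) (w≢v ∘ sym)))
                  (subst (λ d → ¬ 0 < d) (sym (m≡n⇒∣m-n∣≡0 fu≡fw)) λ ())

  record EdgeColours (i : ℕ) : Set where
    field
      spaced : Spaced L
    open Spaced spaced public
    field
      realised : ∀ {j} → j ≤ L → ∃[ u ] (u ∈ E i × f u ≡ seq j)
      covered : ∀ {u} → u ∈ E i → ∃[ j ] (j ≤ L × seq j ≡ f u)

  edgeColours : ∀ {i} → i < m H → EdgeColours i
  edgeColours {i} i<m = record
    { spaced = record { seq = nth sorted ; gap = λ j<L → nth-linked spaced-sorted (lengthᵢ (s≤s j<L)) }
    ; realised = realised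
    ; covered = covered
    }
    where
    vertices = elements (E i)
    colours = map f vertices
    sorted = sort colours

    colours-apart : AllPairs Apart colours
    colours-apart = AllPairs-map⁺ (allPairs-restrict (λ u∈ w∈ u≢w → E-apart u∈ w∈ u≢w)
      (All.tabulate (∈-elements⁻ (E i))) (elements-unique (E i)))

    spaced-sorted : Linked _<₂_ sorted
    spaced-sorted = sort-apart colours-apart

    length-sorted : length sorted ≡ suc L
    length-sorted = trans (↭-length (sort-↭ colours))
      (trans (length-map f vertices) (trans (length-elements (E i)) (∣E∣≡r i<m)))

    lengthᵢ : ∀ {j} → j < suc L → j < length sorted
    lengthᵢ {j} = subst (j <_) (sym length-sorted)

    realised : ∀ {j} → j ≤ L → ∃[ u ] (u ∈ E i × f u ≡ nth sorted j)
    realised j≤L with ∈-map⁻ f (∈-resp-↭ (sort-↭ colours) (nth-∈ sorted (lengthᵢ (s≤s j≤L))))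
    ... | u , u∈ , eq = u , ∈-elements⁻ (E i) u∈ , sym eq

    covered : ∀ {u} → u ∈ E i → ∃[ j ] (j ≤ L × nth sorted j ≡ f u)
    covered u∈ with ∈⇒nth (∈-resp-↭ (↭-sym (sort-↭ colours)) (∈-map⁺ f (∈-elements⁺ (E i) u∈)))
    ... | j , j<len , eq = j , s≤s⁻¹ (subst (j <_) length-sorted j<len) , eq

  module _ {i} (C : EdgeColours i) where
    open EdgeColours C

    minF≤seq : ∀ {j} → j ≤ L → lo ≤ seq j
    minF≤seq j≤L with realised j≤L
    ... | u , _ , fu≡ = subst (lo ≤_) fu≡ (minF≤f f u)

    seq≤maxF : ∀ {j} → j ≤ L → seq j ≤ hi
    seq≤maxF j≤L with realised j≤L
    ... | u , _ , fu≡ = subst (_≤ hi) fu≡ (f≤maxF f u)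

    seq≤span+minF : ∀ {j} → j ≤ L → seq j ≤ span f + lo
    seq≤span+minF j≤L = subst (_ ≤_) (maxF≡span+minF f) (seq≤maxF j≤L)

    edgeWindow : span f ≤ suc (L * 2) → Window lo L
    edgeWindow span≤ = record
      { spaced = spaced
      ; bottom = minF≤seq z≤n
      ; top = ≤-trans (seq≤span+minF ≤-refl) (+-monoˡ-≤ lo span≤)
      }

  2L≤span : 0 < m H → L * 2 ≤ span f
  2L≤span 0<m = +-cancelʳ-≤ lo (L * 2) (span f) (begin
    L * 2 + lo    ≤⟨ +-monoʳ-≤ (L * 2) (minF≤seq C z≤n) ⟩
    L * 2 + seq 0 ≤⟨ spread ≤-refl ⟩
    seq L         ≤⟨ seq≤span+minF C ≤-refl ⟩
    span f + lo   ∎)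
    where
    open ≤-Reasoning
    C = edgeColours 0<m
    open EdgeColours C

  agreement : ∀ {x y v} (A : EdgeColours x) (B : EdgeColours y) (span≤ : span f ≤ suc (L * 2)) →
              v ∈ E x → v ∈ E y → (∀ {u w} → u ∈ E x → w ∈ E y → f u ≡ f w → f u ≡ f v) →
              ∃[ p ] (AgreeOnlyAt (edgeWindow A span≤) (edgeWindow B span≤) p ×
                      EdgeColours.seq B p ≡ f v)
  agreement {v = v} A B span≤ v∈x v∈y shared
    with EdgeColours.covered A v∈x | EdgeColours.covered B v∈y
  ... | p , p≤L , Aₚ≡fv | p′ , p′≤L , Bₚ′≡fv = p , (p≤L , trans Aₚ≡fv (sym Bₚ≡fv) , only) , Bₚ≡fv
    where
    WA = edgeWindow A span≤
    WB = edgeWindow B span≤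
    Bₚ≡fv : EdgeColours.seq B p ≡ f v
    Bₚ≡fv = subst (λ k → EdgeColours.seq B k ≡ f v)
                  (sym (window-aligned WA WB p≤L p′≤L (trans Aₚ≡fv (sym Bₚ′≡fv)))) Bₚ′≡fv
    only : ∀ {j} → j ≤ L → EdgeColours.seq A j ≡ EdgeColours.seq B j → j ≡ p
    only j≤L Aⱼ≡Bⱼ with EdgeColours.realised A j≤L | EdgeColours.realised B j≤L
    ... | u , u∈ , fu≡Aⱼ | w , w∈ , fw≡Bⱼ = window-aligned WA WA j≤L p≤L
            (trans (sym fu≡Aⱼ) (trans (shared u∈ w∈ fu≡fw) (sym Aₚ≡fv)))
      where fu≡fw = trans fu≡Aⱼ (trans Aⱼ≡Bⱼ (sym fw≡Bⱼ))

  tight-colours : ∀ {i} (C : EdgeColours i) → span f ≤ L * 2 →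
                  ∀ {j} → j ≤ L → EdgeColours.seq C j ≡ j * 2 + lo
  tight-colours C span≤2L j≤L = Window.lower-mono W j≤L ≤-refl
    (≤-antisym (≤-trans (seq≤span+minF C ≤-refl) (+-monoˡ-≤ lo span≤2L)) (Window.low W ≤-refl))
    where W = edgeWindow C (m≤n⇒m≤1+n span≤2L)

  2L<span : 1 < m H → 1 ≤ L → L * 2 < span f
  2L<span 1<m 1≤L = ≰⇒> λ span≤2L →
    let _ , (_ , _ , only) , _ = agreement A B (m≤n⇒m≤1+n span≤2L) v∈0 v∈1 (shared-colour v∈0 v∈1)
        agree : ∀ {j} → j ≤ L → j ≡ _
        agree j≤L = only j≤L (trans (tight-colours A span≤2L j≤L) (sym (tight-colours B span≤2L j≤L)))
    in  0≢1+n (trans (agree z≤n) (sym (agree 1≤L)))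
    where
    A = edgeColours (<-trans z<s 1<m)
    B = edgeColours 1<m
    v∈ = shared-vertex 1<m
    v∈0 = proj₁ (proj₂ v∈)
    v∈1 = proj₂ (proj₂ v∈)

  2L+1<span : 2 < m H → 2 ≤ L → suc (L * 2) < span f
  2L+1<span 2<m 2≤L = ≰⇒> λ span≤ →
    let p , agAB , Bₚ≡fv₁ = agreement A B span≤ v₁∈0 v₁∈1 (shared-colour v₁∈0 v₁∈1)
        q , agCB , Bq≡fv₂ = agreement C B span≤ v₂∈2 v₂∈1
          (λ u∈2 w∈1 fu≡fw → trans fu≡fw (shared-colour v₂∈1 v₂∈2 w∈1 u∈2 (sym fu≡fw)))
        p≡q = agreements-coincide {A = edgeWindow A span≤} {edgeWindow B span≤} {edgeWindow C span≤}
                2≤L agAB agCB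
    in  apart⇒≢ (E-apart v₁∈1 v₂∈1 v₁≢v₂)
          (trans (sym Bₚ≡fv₁) (trans (cong (EdgeColours.seq B) p≡q) Bq≡fv₂))
    where
    1<m = <-trans (s≤s (s≤s z≤n)) 2<m
    A = edgeColours (<-trans z<s 1<m)
    B = edgeColours 1<m
    C = edgeColours 2<m
    v₁∈ = shared-vertex {0} 1<m
    v₂∈ = shared-vertex {1} 2<m
    v₁∈0 = proj₁ (proj₂ v₁∈)
    v₁∈1 = proj₂ (proj₂ v₁∈)
    v₂∈1 = proj₁ (proj₂ v₂∈)
    v₂∈2 = proj₂ (proj₂ v₂∈)
    v₁≢v₂ : proj₁ v₁∈ ≢ proj₁ v₂∈
    v₁≢v₂ v₁≡v₂ with common-vertex⇒consecutive v₁∈0 (subst (_∈ E 2) (sym v₁≡v₂) v₂∈2) (s≤s z≤n)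
    ... | ()

indexOf : ∀ {n} → Fin n → List (Fin n) → ℕ
indexOf u [] = 0
indexOf u (x ∷ xs) with u ≟ᶠ x
... | yes _ = 0
... | no _ = suc (indexOf u xs)

indexOf-< : ∀ {n} {u : Fin n} {xs} → u ∈ₗ xs → indexOf u xs < length xs
indexOf-< {u = u} {x ∷ xs} u∈ with u ≟ᶠ x
... | yes _ = z<s
indexOf-< (here u≡x) | no u≢x = contradiction u≡x u≢x
indexOf-< (there u∈) | no _ = s≤s (indexOf-< u∈)

indexOf-injective : ∀ {n} {u w : Fin n} {xs} → u ∈ₗ xs → w ∈ₗ xs →
                    indexOf u xs ≡ indexOf w xs → u ≡ w
indexOf-injective {u = u} {w} {x ∷ xs} u∈ w∈ eq with u ≟ᶠ x | w ≟ᶠ x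
... | yes u≡x | yes w≡x = trans u≡x (sym w≡x)
indexOf-injective (here u≡x) _ _ | no u≢x | _ = contradiction u≡x u≢x
indexOf-injective _ (here w≡x) _ | _ | no w≢x = contradiction w≡x w≢x
indexOf-injective (there u∈) (there w∈) eq | no _ | no _ = indexOf-injective u∈ w∈ (suc-injective eq)

-- The position of a vertex within an edge of the path: shared with the previous edge, shared with
-- the next edge, or the j-th of the remaining vertices.
data Slot : Set where
  entry exit : Slot
  inner : ℕ → Slot

module UpperBound (H : Hypergraph) (L : ℕ) (hp : IsHyperpath H (suc L)) where
  open Hyperpath H (suc L) hp

  previous : ℕ → Subset (n H)
  previous zero = ∅
  previous (suc i) = E i

  interior : ℕ → Subset (n H)
  interior i = E i ∩ ∁ (previous i ∪ E (suc i))

  rank : ℕ → Fin (n H) → ℕ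
  rank i u = indexOf u (elements (interior i))

  slot : ℕ → Fin (n H) → Slot
  slot i u with u ∈? previous i | u ∈? E (suc i)
  ... | yes _ | _ = entry
  ... | no _ | yes _ = exit
  ... | no _ | no _ = inner (rank i u)

  data SlotView (i : ℕ) (u : Fin (n H)) : Slot → Set where
    entry : u ∈ previous i → SlotView i u entry
    exit : u ∉ previous i → u ∈ E (suc i) → SlotView i u exit
    inner : u ∈ interior i → SlotView i u (inner (rank i u))

  slotView : ∀ {i u} → u ∈ E i → SlotView i u (slot i u)
  slotView {i} {u} u∈ with u ∈? previous i | u ∈? E (suc i)
  ... | yes u∈prev | _ = entry u∈prev
  ... | no u∉prev | yes u∈next = exit u∉prev u∈next
  ... | no u∉prev | no u∉next = inner (x∈p∩q⁺ (u∈ , x∉p⇒x∈∁p ([ u∉prev , u∉next ]′ ∘ x∈p∪q⁻ _ _)))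

  interior⊆E : ∀ {i} → interior i ⊆ E i
  interior⊆E = p∩q⊆p _ _

  interior-excludes : ∀ {i u} → u ∈ interior i → ¬ (u ∈ previous i ⊎ u ∈ E (suc i))
  interior-excludes u∈ = x∈∁p⇒x∉p (proj₂ (x∈p∩q⁻ _ _ u∈)) ∘ x∈p∪q⁺

  record InnerIndex (i j : ℕ) : Set where
    field
      ≤L : j ≤ L
      <L-with-entry : 0 < i → j < L
      <L-with-exit : suc i < m H → j < L
      <L∸1-with-both : 0 < i → suc i < m H → suc j < L

  rank<∣interior∣ : ∀ {i u} → u ∈ interior i → rank i u < ∣ interior i ∣
  rank<∣interior∣ {i} {u} u∈ =
    subst (rank i u <_) (length-elements (interior i)) (indexOf-< (∈-elements⁺ (interior i) u∈))

  rank-injective : ∀ {i u w} → u ∈ interior i → w ∈ interior i → rank i u ≡ rank i w → u ≡ w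
  rank-injective {i} u∈ w∈ =
    indexOf-injective (∈-elements⁺ (interior i) u∈) (∈-elements⁺ (interior i) w∈)

  interior⊆E-connector : ∀ {i a} → a ∈ previous i ⊎ a ∈ E (suc i) → interior i ⊆ E i ∖ a
  interior⊆E-connector conn u∈ = x∈p∧x≢y⇒x∈p-y (interior⊆E u∈) λ { refl → interior-excludes u∈ conn }

  previous∩next : ∀ {i a} → a ∈ previous i → a ∈ E (suc i) → ⊥
  previous∩next {zero} a∈ _ = ∉⊥ a∈
  previous∩next {suc k} a∈k a∈2+k =
    <⇒≢ (n<1+n _) (common-vertex⇒consecutive a∈k a∈2+k (<-trans (n<1+n k) (n<1+n (suc k))))

  entry-pos : ∀ {i u} → u ∈ previous i → 0 < i
  entry-pos {zero} u∈ = contradiction u∈ ∉⊥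
  entry-pos {suc _} _ = z<s

  entry-unique : ∀ {i u w} → u ∈ previous i → u ∈ E i → w ∈ previous i → w ∈ E i → u ≡ w
  entry-unique {zero} u∈ = contradiction u∈ ∉⊥
  entry-unique {suc _} = shared-vertex-unique

  entry-vertex : ∀ {i} → 0 < i → i < m H → ∃[ a ] (a ∈ previous i × a ∈ E i)
  entry-vertex {suc _} _ = shared-vertex

  rank-bound : ∀ {i u} → i < m H → u ∈ interior i → InnerIndex i (rank i u)
  rank-bound {i} {u} i<m u∈ = record
    { ≤L = ≤-pred (≤-trans rank< (≤-trans (p⊆q⇒∣p∣≤∣q∣ interior⊆E) (≤-reflexive ∣E∣≡1+L)))
    ; <L-with-entry = λ 0<i →
        let a , a∈prev , a∈ = entry-vertex 0<i i<m in one-connector a∈ (inj₁ a∈prev)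
    ; <L-with-exit = λ 1+i<m →
        let b , b∈ , b∈next = shared-vertex 1+i<m in one-connector b∈ (inj₂ b∈next)
    ; <L∸1-with-both = λ 0<i 1+i<m →
        let a , a∈prev , a∈ = entry-vertex 0<i i<m
            b , b∈ , b∈next = shared-vertex 1+i<m
        in  two-connectors a∈ b∈ a∈prev b∈next
    }
    where
    rank< = rank<∣interior∣ u∈
    ∣E∣≡1+L = ∣E∣≡r i<m
    one-connector : ∀ {a} → a ∈ E i → a ∈ previous i ⊎ a ∈ E (suc i) → rank i u < L
    one-connector {a} a∈ conn = ≤-pred (begin-strict
      suc (rank i u)   ≤⟨ rank< ⟩
      ∣ interior i ∣   ≤⟨ p⊆q⇒∣p∣≤∣q∣ (interior⊆E-connector conn) ⟩
      ∣ E i ∖ a ∣      <⟨ x∈p⇒∣p-x∣<∣p∣ a∈ ⟩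
      ∣ E i ∣          ≡⟨ ∣E∣≡1+L ⟩
      suc L            ∎)
      where open ≤-Reasoning
    two-connectors : ∀ {a b} → a ∈ E i → b ∈ E i → a ∈ previous i → b ∈ E (suc i) → suc (rank i u) < L
    two-connectors {a} {b} a∈ b∈ a∈prev b∈next = ≤-pred (begin-strict
      suc (suc (rank i u)) ≤⟨ s≤s rank< ⟩
      suc ∣ interior i ∣   ≤⟨ s≤s (p⊆q⇒∣p∣≤∣q∣ interior⊆E-a-b) ⟩
      suc ∣ E i ∖ a ∖ b ∣  ≤⟨ x∈p⇒∣p-x∣<∣p∣ (x∈p∧x≢y⇒x∈p-y b∈ b≢a) ⟩
      ∣ E i ∖ a ∣          <⟨ x∈p⇒∣p-x∣<∣p∣ a∈ ⟩
      ∣ E i ∣              ≡⟨ ∣E∣≡1+L ⟩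
      suc L                ∎)
      where
      open ≤-Reasoning
      b≢a : b ≢ a
      b≢a refl = previous∩next a∈prev b∈next
      interior⊆E-a-b : interior i ⊆ E i ∖ a ∖ b
      interior⊆E-a-b u∈ = x∈p∧x≢y⇒x∈p-y (interior⊆E-connector (inj₁ a∈prev) u∈)
                                        λ { refl → interior-excludes u∈ (inj₂ b∈next) }

  record SlotColouring (B : ℕ) : Set where
    field
      colour : ℕ → Slot → ℕ
      entry#exit : ∀ {i} → 0 < i → suc i < m H → Apart (colour i entry) (colour i exit)
      entry#inner : ∀ {i j} → 0 < i → i < m H → InnerIndex i j →
                    Apart (colour i entry) (colour i (inner j))
      exit#inner : ∀ {i j} → suc i < m H → InnerIndex i j → Apart (colour i exit) (colour i (inner j))
      inner#inner : ∀ {i j j′} → i < m H → InnerIndex i j → InnerIndex i j′ → j ≢ j′ →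
                    Apart (colour i (inner j)) (colour i (inner j′))
      exit≡entry : ∀ {i} → suc i < m H → colour i exit ≡ colour (suc i) entry
      entry≢exit : ∀ {i} → 0 < i → suc (suc i) < m H → colour i entry ≢ colour (suc i) exit
      entry≢inner : ∀ {i j} → 0 < i → suc i < m H → InnerIndex (suc i) j →
                    colour i entry ≢ colour (suc i) (inner j)
      inner≢exit : ∀ {i j} → suc (suc i) < m H → InnerIndex i j →
                   colour i (inner j) ≢ colour (suc i) exit
      inner≢inner : ∀ {i j j′} → suc i < m H → InnerIndex i j → InnerIndex (suc i) j′ →
                    colour i (inner j) ≢ colour (suc i) (inner j′)
      entry≤ : ∀ {i} → 0 < i → i < m H → colour i entry ≤ B
      exit≤ : ∀ {i} → suc i < m H → colour i exit ≤ B
      inner≤ : ∀ {i j} → i < m H → InnerIndex i j → colour i (inner j) ≤ B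

  module _ {B : ℕ} (S : SlotColouring B) where
    open SlotColouring S

    edgeColour : ℕ → Fin (n H) → ℕ
    edgeColour i u = colour i (slot i u)

    -- A vertex takes its colour from the first edge containing it.
    colourFrom : Fin (n H) → ℕ → ℕ → ℕ
    colourFrom u k zero = 0
    colourFrom u k (suc d) with u ∈? E k
    ... | yes _ = edgeColour k u
    ... | no _ = colourFrom u (suc k) d

    vertexColour : Fin (n H) → ℕ
    vertexColour u = colourFrom u 0 (m H)

    edgeColour-consecutive : ∀ {k u} → u ∈ E k → u ∈ E (suc k) → edgeColour k u ≡ edgeColour (suc k) u
    edgeColour-consecutive {k} {u} u∈k u∈k′ = go (slotView u∈k) (slotView u∈k′)
      where
      go : ∀ {s t} → SlotView k u s → SlotView (suc k) u t → colour k s ≡ colour (suc k) t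
      go (entry u∈prev) _ = ⊥-elim (previous∩next u∈prev u∈k′)
      go (inner u∈int) _ = ⊥-elim (interior-excludes u∈int (inj₂ u∈k′))
      go _ (exit u∉prev _) = ⊥-elim (u∉prev u∈k)
      go _ (inner u∈int) = ⊥-elim (interior-excludes u∈int (inj₁ u∈k))
      go (exit _ _) (entry _) = exit≡entry (∈E⇒<m u∈k′)

    colourFrom-≡ : ∀ {u i} d k → u ∈ E i → k ≤ i → i < k + d → colourFrom u k d ≡ edgeColour i u
    colourFrom-≡ {u} {i} zero k _ k≤i i<k+0 = ⊥-elim (≤⇒≯ k≤i (subst (i <_) (+-identityʳ k) i<k+0))
    colourFrom-≡ {u} {i} (suc d) k u∈i k≤i i<k+d with u ∈? E k | m≤n⇒m<n∨m≡n k≤i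
    ... | yes _ | inj₂ refl = refl
    ... | no u∉i | inj₂ refl = contradiction u∈i u∉i
    ... | yes u∈k | inj₁ k<i with common-vertex⇒consecutive u∈k u∈i k<i
    ...   | refl = edgeColour-consecutive u∈k u∈i
    colourFrom-≡ {u} {i} (suc d) k u∈i k≤i i<k+d | no u∉k | inj₁ k<i =
      colourFrom-≡ d (suc k) u∈i k<i (subst (i <_) (+-suc k d) i<k+d)

    vertexColour≡ : ∀ {u i} → u ∈ E i → vertexColour u ≡ edgeColour i u
    vertexColour≡ u∈ = colourFrom-≡ _ 0 u∈ z≤n (∈E⇒<m u∈)

    edgeColour≤ : ∀ {u i} → u ∈ E i → edgeColour i u ≤ B
    edgeColour≤ {u} {i} u∈ = go (slotView u∈)
      where
      i<m = ∈E⇒<m u∈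
      go : ∀ {s} → SlotView i u s → colour i s ≤ B
      go (entry u∈prev) = entry≤ (entry-pos u∈prev) i<m
      go (exit _ u∈next) = exit≤ (∈E⇒<m u∈next)
      go (inner u∈int) = inner≤ i<m (rank-bound i<m u∈int)

    vertexColour≤ : ∀ u → vertexColour u ≤ B
    vertexColour≤ u = go 0 (m H)
      where
      go : ∀ k d → colourFrom u k d ≤ B
      go k zero = z≤n
      go k (suc d) with u ∈? E k
      ... | yes u∈ = edgeColour≤ u∈
      ... | no _ = go (suc k) d

    same-edge-apart : ∀ {u w i} → u ∈ E i → w ∈ E i → u ≢ w → Apart (edgeColour i u) (edgeColour i w)
    same-edge-apart {u} {w} {i} u∈ w∈ u≢w = go (slotView u∈) (slotView w∈)
      where
      i<m = ∈E⇒<m u∈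
      go : ∀ {s t} → SlotView i u s → SlotView i w t → Apart (colour i s) (colour i t)
      go (entry u∈prev) (entry w∈prev) = contradiction (entry-unique u∈prev u∈ w∈prev w∈) u≢w
      go (entry u∈prev) (exit _ w∈next) = entry#exit (entry-pos u∈prev) (∈E⇒<m w∈next)
      go (entry u∈prev) (inner w∈int) = entry#inner (entry-pos u∈prev) i<m (rank-bound i<m w∈int)
      go (exit _ u∈next) (entry w∈prev) = apart-sym (entry#exit (entry-pos w∈prev) (∈E⇒<m u∈next))
      go (exit _ u∈next) (exit _ w∈next) = contradiction (shared-vertex-unique u∈ u∈next w∈ w∈next) u≢w
      go (exit _ u∈next) (inner w∈int) = exit#inner (∈E⇒<m u∈next) (rank-bound i<m w∈int)
      go (inner u∈int) (entry w∈prev) =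
        apart-sym (entry#inner (entry-pos w∈prev) i<m (rank-bound i<m u∈int))
      go (inner u∈int) (exit _ w∈next) = apart-sym (exit#inner (∈E⇒<m w∈next) (rank-bound i<m u∈int))
      go (inner u∈int) (inner w∈int) =
        inner#inner i<m (rank-bound i<m u∈int) (rank-bound i<m w∈int) (u≢w ∘ rank-injective u∈int w∈int)

    consecutive-edges-differ : ∀ {u w i} → u ∈ E i → w ∈ E (suc i) → u ≢ w →
                               edgeColour i u ≢ edgeColour (suc i) w
    consecutive-edges-differ {u} {w} {i} u∈ w∈ u≢w = go (slotView u∈) (slotView w∈)
      where
      1+i<m = ∈E⇒<m w∈
      entry≡exit : colour (suc i) entry ≡ colour i exit
      entry≡exit = sym (exit≡entry 1+i<m)
      go : ∀ {s t} → SlotView i u s → SlotView (suc i) w t → colour i s ≢ colour (suc i) t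
      go (entry u∈prev) (entry _) eq =
        apart⇒≢ (entry#exit (entry-pos u∈prev) 1+i<m) (trans eq entry≡exit)
      go (entry u∈prev) (exit _ w∈next) = entry≢exit (entry-pos u∈prev) (∈E⇒<m w∈next)
      go (entry u∈prev) (inner w∈int) = entry≢inner (entry-pos u∈prev) 1+i<m (rank-bound 1+i<m w∈int)
      go (exit _ u∈next) (entry w∈prev) = contradiction (shared-vertex-unique u∈ u∈next w∈prev w∈) u≢w
      go (exit _ _) (exit _ w∈next) eq =
        apart⇒≢ (entry#exit z<s (∈E⇒<m w∈next)) (trans entry≡exit eq)
      go (exit _ _) (inner w∈int) eq =
        apart⇒≢ (entry#inner z<s 1+i<m (rank-bound 1+i<m w∈int)) (trans entry≡exit eq)
      go (inner u∈int) (entry _) eq =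
        apart⇒≢ (exit#inner 1+i<m (rank-bound i<m u∈int)) (trans (sym entry≡exit) (sym eq))
        where i<m = ∈E⇒<m u∈
      go (inner u∈int) (exit _ w∈next) = inner≢exit (∈E⇒<m w∈next) (rank-bound (∈E⇒<m u∈) u∈int)
      go (inner u∈int) (inner w∈int) =
        inner≢inner 1+i<m (rank-bound (∈E⇒<m u∈) u∈int) (rank-bound 1+i<m w∈int)

    vertexColour-L21 : IsL21 H vertexColour
    vertexColour-L21 =
      (λ u w u≢w adj → Apart.2≤∣-∣ (same-edge (adjacent⇒same-edge adj) u≢w)) , distance2-distinct
      where
      same-edge : ∀ {u w} → SameEdge u w → u ≢ w → Apart (vertexColour u) (vertexColour w)
      same-edge (_ , u∈ , w∈) u≢w =
        subst₂ Apart (sym (vertexColour≡ u∈)) (sym (vertexColour≡ w∈)) (same-edge-apart u∈ w∈ u≢w)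
      consecutive : ∀ {u w} → ConsecutiveEdges u w → u ≢ w → vertexColour u ≢ vertexColour w
      consecutive (_ , u∈ , w∈) u≢w eq =
        consecutive-edges-differ u∈ w∈ u≢w (trans (sym (vertexColour≡ u∈)) (trans eq (vertexColour≡ w∈)))
      distance2-distinct : ∀ u w → u ≢ w → Distance2 H u w → 0 < ∣ vertexColour u - vertexColour w ∣
      distance2-distinct u w u≢w d2 with distance2-cases d2
      ... | inj₁ same = ≤-trans (s≤s z≤n) (Apart.2≤∣-∣ (same-edge same u≢w))
      ... | inj₂ (inj₁ cons) = ≢⇒0<∣-∣ (consecutive cons u≢w)
      ... | inj₂ (inj₂ cons) = ≢⇒0<∣-∣ (≢-sym (consecutive cons (≢-sym u≢w)))

    slotColouring-L21 : ∃[ f ] (IsL21 H f × span f ≤ B)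
    slotColouring-L21 = vertexColour , vertexColour-L21 , span≤ vertexColour vertexColour≤

apart-multiples : ∀ b {j j′} → j ≢ j′ → Apart (b + j * 2) (b + j′ * 2)
apart-multiples b {j} {j′} j≢j′ =
  apart (subst (2 ≤_) (sym (∣m+n-m+o∣≡∣n-o∣ b (j * 2) (j′ * 2))) (Apart.2≤∣-∣ multiples-apart))
  where
  multiples-apart : Apart (j * 2) (j′ * 2)
  multiples-apart with <-cmp j j′
  ... | tri< j<j′ _ _ = 2+≤⇒apart (*-monoˡ-≤ 2 j<j′)
  ... | tri≈ _ j≡j′ _ = contradiction j≡j′ j≢j′
  ... | tri> _ _ j′<j = apart-sym (2+≤⇒apart (*-monoˡ-≤ 2 j′<j))

parity-differs : ∀ {b b′} j j′ → b % 2 ≢ b′ % 2 → b + j * 2 ≢ b′ + j′ * 2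
parity-differs {b} {b′} j j′ b≢b′ eq = b≢b′ (begin
  b % 2             ≡⟨ [m+kn]%n≡m%n b j 2 ⟨
  (b + j * 2) % 2   ≡⟨ cong (_% 2) eq ⟩
  (b′ + j′ * 2) % 2 ≡⟨ [m+kn]%n≡m%n b′ j′ 2 ⟩
  b′ % 2            ∎)
  where open ≡-Reasoning

module SingleEdge {H : Hypergraph} {L : ℕ} (hp : IsHyperpath H (suc L)) (m≡1 : m H ≡ 1) where
  open UpperBound H L hp

  private
    no-next : ∀ {i} → suc i < m H → ⊥
    no-next 1+i<m with subst (_ <_) m≡1 1+i<m
    ... | s≤s ()

    colour : ℕ → Slot → ℕ
    colour _ entry = 0
    colour _ exit = 0
    colour _ (inner j) = j * 2

  slotColouring : SlotColouring (L * 2)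
  slotColouring = record
    { colour = colour
    ; entry#exit = λ _ 1+i<m → ⊥-elim (no-next 1+i<m)
    ; entry#inner = λ { {suc _} _ 1+i<m _ → ⊥-elim (no-next 1+i<m) }
    ; exit#inner = λ 1+i<m _ → ⊥-elim (no-next 1+i<m)
    ; inner#inner = λ _ _ _ j≢j′ → apart-multiples 0 j≢j′
    ; exit≡entry = λ _ → refl
    ; entry≢exit = λ _ 2+i<m → ⊥-elim (no-next 2+i<m)
    ; entry≢inner = λ _ 1+i<m _ → ⊥-elim (no-next 1+i<m)
    ; inner≢exit = λ 2+i<m _ → ⊥-elim (no-next 2+i<m)
    ; inner≢inner = λ 1+i<m _ _ → ⊥-elim (no-next 1+i<m)
    ; entry≤ = λ _ _ → z≤n
    ; exit≤ = λ _ → z≤n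
    ; inner≤ = λ _ idx → *-monoˡ-≤ 2 (InnerIndex.≤L idx)
    }

module TwoEdges {H : Hypergraph} {L : ℕ} (hp : IsHyperpath H (suc L)) (m≡2 : m H ≡ 2) where
  open UpperBound H L hp

  private
    no-second-next : ∀ {i} → suc (suc i) < m H → ⊥
    no-second-next 2+i<m with subst (_ <_) m≡2 2+i<m
    ... | s≤s (s≤s ())

    colour : ℕ → Slot → ℕ
    colour _ entry = 0
    colour _ exit = 0
    colour zero (inner j) = 2 + j * 2
    colour (suc _) (inner j) = 3 + j * 2

    inner#inner : ∀ i {j j′} → j ≢ j′ → Apart (colour i (inner j)) (colour i (inner j′))
    inner#inner zero = apart-multiples 2
    inner#inner (suc _) = apart-multiples 3

    inner≤ : ∀ {i j} → InnerIndex i j → colour i (inner j) ≤ suc (L * 2)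
    inner≤ {zero} idx =
      m≤n⇒m≤1+n (*-monoˡ-≤ 2 (InnerIndex.<L-with-exit idx (subst (1 <_) (sym m≡2) ≤-refl)))
    inner≤ {suc _} idx = s≤s (*-monoˡ-≤ 2 (InnerIndex.<L-with-entry idx z<s))

  slotColouring : SlotColouring (suc (L * 2))
  slotColouring = record
    { colour = colour
    ; entry#exit = λ { {suc _} _ 2+i<m → ⊥-elim (no-second-next 2+i<m) }
    ; entry#inner = λ { {suc _} _ _ _ → 2+≤⇒apart (s≤s (s≤s z≤n)) }
    ; exit#inner = λ { {zero} _ _ → 2+≤⇒apart (s≤s (s≤s z≤n))
                     ; {suc _} 2+i<m _ → ⊥-elim (no-second-next 2+i<m) }
    ; inner#inner = λ {i} _ _ _ → inner#inner i
    ; exit≡entry = λ _ → refl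
    ; entry≢exit = λ _ 2+i<m → ⊥-elim (no-second-next 2+i<m)
    ; entry≢inner = λ { {suc _} _ 2+i<m _ → ⊥-elim (no-second-next 2+i<m) }
    ; inner≢exit = λ 2+i<m _ → ⊥-elim (no-second-next 2+i<m)
    ; inner≢inner = λ { {zero} {j} {j′} _ _ _ → parity-differs j j′ λ ()
                      ; {suc _} 2+i<m _ _ → ⊥-elim (no-second-next 2+i<m) }
    ; entry≤ = λ _ _ → z≤n
    ; exit≤ = λ _ → z≤n
    ; inner≤ = λ _ → inner≤
    }

-- Shared vertices get the low colours 0, 1 or the high colours
-- 2r − 1, 2r; the remaining vertices of a middle edge get base + 2j, with bases 2, 3, 4, 3 of
-- alternating parity, those of the first edge get 2 + 2j, and the one extra remaining vertex of the
-- last edge reuses the colour its missing exit vertex would have had.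
module LongPath {H : Hypergraph} {k : ℕ} (hp : IsHyperpath H (3 + k)) (3≤m : 3 ≤ m H) where
  open UpperBound H (2 + k) hp

  data Phase : Set where
    φ₀ φ₁ φ₂ φ₃ : Phase

  next : Phase → Phase
  next φ₀ = φ₁
  next φ₁ = φ₂
  next φ₂ = φ₃
  next φ₃ = φ₀

  phase : ℕ → Phase
  phase zero = φ₀
  phase (suc i) = next (phase i)

  entryColour exitColour base : Phase → ℕ
  entryColour φ₀ = 5 + k * 2
  entryColour φ₁ = 0
  entryColour φ₂ = 6 + k * 2
  entryColour φ₃ = 1
  exitColour φ₀ = 0
  exitColour φ₁ = 6 + k * 2
  exitColour φ₂ = 1
  exitColour φ₃ = 5 + k * 2
  base φ₀ = 2
  base φ₁ = 3
  base φ₂ = 4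
  base φ₃ = 3

  exit≡entry-next : ∀ t → exitColour t ≡ entryColour (next t)
  exit≡entry-next φ₀ = refl
  exit≡entry-next φ₁ = refl
  exit≡entry-next φ₂ = refl
  exit≡entry-next φ₃ = refl

  entry≢exit-next : ∀ t → entryColour t ≢ exitColour (next t)
  entry≢exit-next φ₀ = <⇒≢ (n<1+n _)
  entry≢exit-next φ₁ = λ ()
  entry≢exit-next φ₂ = ≢-sym (<⇒≢ (n<1+n _))
  entry≢exit-next φ₃ = λ ()

  base-parity : ∀ t → base t % 2 ≢ base (next t) % 2
  base-parity φ₀ = λ ()
  base-parity φ₁ = λ ()
  base-parity φ₂ = λ ()
  base-parity φ₃ = λ ()

  data Connector : ℕ → Set where
    c₀ : Connector 0
    c₁ : Connector 1
    c₅ : Connector (5 + k * 2)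
    c₆ : Connector (6 + k * 2)

  entry-connector : ∀ t → Connector (entryColour t)
  entry-connector φ₀ = c₅
  entry-connector φ₁ = c₀
  entry-connector φ₂ = c₆
  entry-connector φ₃ = c₁

  exit-connector : ∀ t → Connector (exitColour t)
  exit-connector φ₀ = c₀
  exit-connector φ₁ = c₆
  exit-connector φ₂ = c₁
  exit-connector φ₃ = c₅

  connector≤ : ∀ {c} → Connector c → c ≤ 6 + k * 2
  connector≤ c₀ = z≤n
  connector≤ c₁ = s≤s z≤n
  connector≤ c₅ = n≤1+n _
  connector≤ c₆ = ≤-refl

  Mid : ℕ → Set
  Mid x = 2 ≤ x × x ≤ 4 + k * 2

  mid≤ : ∀ {x} → Mid x → x ≤ 6 + k * 2
  mid≤ (_ , x≤) = ≤-trans x≤ (≤-trans (n≤1+n _) (n≤1+n _))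

  mid≢connector : ∀ {x c} → Mid x → Connector c → x ≢ c
  mid≢connector (() , _) c₀ refl
  mid≢connector (s≤s () , _) c₁ refl
  mid≢connector (_ , x≤) c₅ refl = 1+n≰n x≤
  mid≢connector (_ , x≤) c₆ refl = 1+n≰n (≤-trans (n≤1+n _) x≤)

  base-mid : ∀ t {j} → j ≤ k → Mid (base t + j * 2)
  base-mid t j≤k = ≤-trans (2≤base t) (m≤m+n _ _) , +-mono-≤ (base≤4 t) (*-monoˡ-≤ 2 j≤k)
    where
    2≤base : ∀ t → 2 ≤ base t
    2≤base φ₀ = ≤-refl
    2≤base φ₁ = n≤1+n _
    2≤base φ₂ = ≤-trans (n≤1+n _) (n≤1+n _)
    2≤base φ₃ = n≤1+n _
    base≤4 : ∀ t → base t ≤ 4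
    base≤4 φ₀ = ≤-trans (n≤1+n _) (n≤1+n _)
    base≤4 φ₁ = n≤1+n _
    base≤4 φ₂ = ≤-refl
    base≤4 φ₃ = n≤1+n _

  first-mid : ∀ {j} → j ≤ suc k → Mid (2 + j * 2)
  first-mid j≤1+k = s≤s (s≤s z≤n) , s≤s (s≤s (*-monoˡ-≤ 2 j≤1+k))

  private
    below : ∀ {c b} j → 2 + c ≤ b → Apart c (b + j * 2)
    below _ 2+c≤b = 2+≤⇒apart (≤-trans 2+c≤b (m≤m+n _ _))

    above : ∀ {c b j} → j ≤ k → 2 + (b + k * 2) ≤ c → Apart c (b + j * 2)
    above {c} {b} j≤k top≤c =
      apart-sym (2+≤⇒apart (≤-trans (s≤s (s≤s (+-monoʳ-≤ b (*-monoˡ-≤ 2 j≤k)))) top≤c))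

  entry#inner-phase : ∀ t {j} → j ≤ k → Apart (entryColour t) (base t + j * 2)
  entry#inner-phase φ₀ j≤k = above j≤k (n≤1+n _)
  entry#inner-phase φ₁ {j} _ = below j (n≤1+n _)
  entry#inner-phase φ₂ j≤k = above j≤k ≤-refl
  entry#inner-phase φ₃ {j} _ = below j ≤-refl

  exit#inner-phase : ∀ t {j} → j ≤ k → Apart (exitColour t) (base t + j * 2)
  exit#inner-phase φ₀ {j} _ = below j ≤-refl
  exit#inner-phase φ₁ j≤k = above j≤k (n≤1+n _)
  exit#inner-phase φ₂ {j} _ = below j (n≤1+n _)
  exit#inner-phase φ₃ j≤k = above j≤k ≤-refl

  entry#exit-phase : ∀ t → Apart (entryColour t) (exitColour t)
  entry#exit-phase φ₀ = apart-sym (2+≤⇒apart (s≤s (s≤s z≤n)))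
  entry#exit-phase φ₁ = 2+≤⇒apart (s≤s (s≤s z≤n))
  entry#exit-phase φ₂ = apart-sym (2+≤⇒apart (s≤s (s≤s (s≤s z≤n))))
  entry#exit-phase φ₃ = 2+≤⇒apart (s≤s (s≤s (s≤s z≤n)))

  later : Phase → ℕ → ℕ
  later t j with j ≤? k
  ... | yes _ = base t + j * 2
  ... | no _ = exitColour t

  data LaterView (t : Phase) (j : ℕ) : ℕ → Set where
    regular : j ≤ k → LaterView t j (base t + j * 2)
    spare : ¬ j ≤ k → LaterView t j (exitColour t)

  laterView : ∀ t j → LaterView t j (later t j)
  laterView t j with j ≤? k
  ... | yes j≤k = regular j≤k
  ... | no j≰k = spare j≰k

  colour : ℕ → Slot → ℕ
  colour i entry = entryColour (phase i)
  colour i exit = exitColour (phase i)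
  colour zero (inner j) = 2 + j * 2
  colour (suc i) (inner j) = later (phase (suc i)) j

  later≡base : ∀ t {j} → j ≤ k → later t j ≡ base t + j * 2
  later≡base t {j} j≤k with j ≤? k
  ... | yes _ = refl
  ... | no j≰k = contradiction j≤k j≰k

  middle-bound : ∀ {i j} → InnerIndex i j → 0 < i → suc i < m H → j ≤ k
  middle-bound idx 0<i 1+i<m = ≤-pred (≤-pred (InnerIndex.<L∸1-with-both idx 0<i 1+i<m))

  nonfinal-inner≡ : ∀ {i j} → suc i < m H → InnerIndex i j →
                    colour i (inner j) ≡ base (phase i) + j * 2
  nonfinal-inner≡ {zero} _ _ = refl
  nonfinal-inner≡ {suc i} 2+i<m idx = later≡base _ (middle-bound idx z<s 2+i<m)

  nonfinal-mid : ∀ {i j} → suc i < m H → InnerIndex i j → Mid (colour i (inner j))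
  nonfinal-mid {zero} 1<m idx = first-mid (≤-pred (InnerIndex.<L-with-exit idx 1<m))
  nonfinal-mid {suc i} 2+i<m idx = subst Mid (sym (later≡base _ j≤k)) (base-mid _ j≤k)
    where j≤k = middle-bound idx z<s 2+i<m

  entry#later : ∀ t j → Apart (entryColour t) (later t j)
  entry#later t j with later t j | laterView t j
  ... | _ | regular j≤k = entry#inner-phase t j≤k
  ... | _ | spare _ = entry#exit-phase t

  later#later : ∀ t {j j′} → j ≤ suc k → j′ ≤ suc k → j ≢ j′ → Apart (later t j) (later t j′)
  later#later t {j} {j′} j≤1+k j′≤1+k j≢j′ with later t j | laterView t j | later t j′ | laterView t j′
  ... | _ | regular _ | _ | regular _ = apart-multiples (base t) j≢j′
  ... | _ | regular j≤k | _ | spare _ = apart-sym (exit#inner-phase t j≤k)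
  ... | _ | spare _ | _ | regular j′≤k = exit#inner-phase t j′≤k
  ... | _ | spare j≰k | _ | spare j′≰k =
    contradiction (trans (≤-antisym j≤1+k (≰⇒> j≰k)) (sym (≤-antisym j′≤1+k (≰⇒> j′≰k)))) j≢j′

  entry≢later : ∀ t j → entryColour t ≢ later (next t) j
  entry≢later t j with later (next t) j | laterView (next t) j
  ... | _ | regular j≤k = mid≢connector (base-mid (next t) j≤k) (entry-connector t) ∘ sym
  ... | _ | spare _ = entry≢exit-next t

  later≤ : ∀ t j → later t j ≤ 6 + k * 2
  later≤ t j with later t j | laterView t j
  ... | _ | regular j≤k = mid≤ (base-mid t j≤k)
  ... | _ | spare _ = connector≤ (exit-connector t)

  nonfinal≢later : ∀ {i j} → suc i < m H → InnerIndex i j → ∀ j′ →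
                   colour i (inner j) ≢ later (next (phase i)) j′
  nonfinal≢later {i} {j} 1+i<m idx j′ with later (next (phase i)) j′ | laterView (next (phase i)) j′
  ... | _ | regular _ =
    parity-differs j j′ (base-parity (phase i)) ∘ trans (sym (nonfinal-inner≡ 1+i<m idx))
  ... | _ | spare _ = mid≢connector (nonfinal-mid 1+i<m idx) (exit-connector (next (phase i)))

  private
    1<m : 1 < m H
    1<m = ≤-trans (s≤s (s≤s z≤n)) 3≤m

    later-index : ∀ {i j} → InnerIndex (suc i) j → j ≤ suc k
    later-index idx = ≤-pred (InnerIndex.<L-with-entry idx z<s)

    exit#inner : ∀ {i j} → suc i < m H → InnerIndex i j → Apart (colour i exit) (colour i (inner j))
    exit#inner {zero} _ _ = 2+≤⇒apart (s≤s (s≤s z≤n))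
    exit#inner {suc i} 2+i<m idx =
      subst (Apart _) (sym (later≡base _ j≤k)) (exit#inner-phase (phase (suc i)) j≤k)
      where j≤k = middle-bound idx z<s 2+i<m

    inner#inner : ∀ {i j j′} → InnerIndex i j → InnerIndex i j′ → j ≢ j′ →
                  Apart (colour i (inner j)) (colour i (inner j′))
    inner#inner {zero} _ _ = apart-multiples 2
    inner#inner {suc i} idx idx′ = later#later (phase (suc i)) (later-index idx) (later-index idx′)

    inner≤ : ∀ {i j} → InnerIndex i j → colour i (inner j) ≤ 6 + k * 2
    inner≤ {zero} idx = mid≤ (first-mid (≤-pred (InnerIndex.<L-with-exit idx 1<m)))
    inner≤ {suc i} {j} _ = later≤ (phase (suc i)) j

  slotColouring : SlotColouring (6 + k * 2)
  slotColouring = record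
    { colour = colour
    ; entry#exit = λ {i} _ _ → entry#exit-phase (phase i)
    ; entry#inner = λ { {suc i} {j} _ _ _ → entry#later (phase (suc i)) j }
    ; exit#inner = exit#inner
    ; inner#inner = λ _ → inner#inner
    ; exit≡entry = λ {i} _ → exit≡entry-next (phase i)
    ; entry≢exit = λ {i} _ _ → entry≢exit-next (phase i)
    ; entry≢inner = λ {i} {j} _ _ _ → entry≢later (phase i) j
    ; inner≢exit = λ {i} 2+i<m idx →
        mid≢connector (nonfinal-mid (<-trans (n<1+n _) 2+i<m) idx) (exit-connector (phase (suc i)))
    ; inner≢inner = λ {_} {_} {j′} 1+i<m idx _ → nonfinal≢later 1+i<m idx j′
    ; entry≤ = λ {i} _ _ → connector≤ (entry-connector (phase i))
    ; exit≤ = λ {i} _ → connector≤ (exit-connector (phase i))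
    ; inner≤ = λ _ → inner≤
    }

lambda-from-bounds : ∀ {H s} → ∃[ f ] (IsL21 H f × span f ≤ s) → (∀ f → IsL21 H f → s ≤ span f) →
                     LambdaIs H s
lambda-from-bounds (f , f-L21 , span≤s) s≤span =
  (f , f-L21 , ≤-antisym span≤s (s≤span f f-L21)) , s≤span

single-edge-lambda : ∀ {H L} → IsHyperpath H (suc L) → m H ≡ 1 → LambdaIs H (L * 2)
single-edge-lambda {H} {L} hp m≡1 = lambda-from-bounds {H}
  (UpperBound.slotColouring-L21 H L hp (SingleEdge.slotColouring hp m≡1))
  (λ _ f-L21 → LowerBound.2L≤span H L hp f-L21 (subst (0 <_) (sym m≡1) z<s))

two-edges-lambda : ∀ {H L} → IsHyperpath H (suc L) → 1 ≤ L → m H ≡ 2 → LambdaIs H (suc (L * 2))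
two-edges-lambda {H} {L} hp 1≤L m≡2 = lambda-from-bounds {H}
  (UpperBound.slotColouring-L21 H L hp (TwoEdges.slotColouring hp m≡2))
  (λ _ f-L21 → LowerBound.2L<span H L hp f-L21 (subst (1 <_) (sym m≡2) ≤-refl) 1≤L)

long-path-lambda : ∀ {H k} → IsHyperpath H (3 + k) → 3 ≤ m H → LambdaIs H (6 + k * 2)
long-path-lambda {H} {k} hp 3≤m = lambda-from-bounds {H}
  (UpperBound.slotColouring-L21 H (2 + k) hp (LongPath.slotColouring hp 3≤m))
  (λ _ f-L21 → LowerBound.2L+1<span H (2 + k) hp f-L21 3≤m (s≤s (s≤s z≤n)))

mainTheorem12 : (H : Hypergraph) (r : ℕ) → 3 ≤ r → IsHyperpath H r →
    (m H ≡ 1 → LambdaIs H (2 * r ∸ 2)) ×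
    (m H ≡ 2 → LambdaIs H (2 * r ∸ 1)) ×
    (3 ≤ m H → LambdaIs H (2 * r))
mainTheorem12 H r@(suc (suc (suc k))) (s≤s (s≤s (s≤s _))) hp =
  (λ m≡1 → subst (LambdaIs H) (sym 2r∸2≡) (single-edge-lambda {H} hp m≡1)) ,
  (λ m≡2 → subst (LambdaIs H) (sym 2r∸1≡) (two-edges-lambda {H} hp (s≤s z≤n) m≡2)) ,
  (λ 3≤m → subst (LambdaIs H) (sym 2r≡) (long-path-lambda {H} hp 3≤m))
  where
  2r≡ : 2 * r ≡ r * 2
  2r≡ = *-comm 2 r
  2r∸2≡ : 2 * r ∸ 2 ≡ (2 + k) * 2
  2r∸2≡ = cong (_∸ 2) 2r≡
  2r∸1≡ : 2 * r ∸ 1 ≡ suc ((2 + k) * 2)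
  2r∸1≡ = cong (_∸ 1) 2r≡
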